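{- Let $G$ be a graph obtained from an odd cycle $C$ by adding feet to some of the vertices of $C$. Then $\mathit{pW}(G)=2$ if and only if there are three consecutive vertices $u,v,w$ on $C$ such that $u$ is adjacent to at most one foot, $w$ is adjacent to at most one foot, and all vertices of $C$ other than $u,v,w$ are incident with no feet.
   Context: All graphs are finite and simple. Adding a foot to a vertex $x$ of the cycle means adding a new vertex and joining it by an edge to exactly $x$; a vertex may receive any number of feet, and at least one foot is added in total. An edge-coloring of $G$ is any assignment of colors to the edges (not necessarily proper). A walk is properly colored if no two consecutive edges have the same color. For a connected graph $G$, $\mathit{pW}(G)$ is the minimum number of colors in an edge-coloring of $G$ such that between every pair of vertices there is a properly colored walk. -}

module Defs where

open import Data.Nat using (ℕ; zero; suc; _+_; _*_; _≤_)
open import Data.Nat.DivMod using (_mod_)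
open import Data.Fin using (Fin; toℕ)
open import Data.Sum using (_⊎_)
open import Data.Product using (Σ; _×_; _,_; ∃-syntax)
open import Relation.Binary.PropositionalEquality using (_≡_; _≢_)

next : {n : ℕ} → Fin (suc n) → Fin (suc n)
next {n} i = suc (toℕ i) mod (suc n)

-- The graph obtained from the cycle C_n (n = suc n') by attaching
-- `feet i` pendant vertices to cycle vertex i.
-- Vertices: cycle vertices, and feet (i , j) with j < feet i.
data Vertex (n : ℕ) (feet : Fin (suc n) → ℕ) : Set where
  cv   : Fin (suc n) → Vertex n feet
  foot : (i : Fin (suc n)) → Fin (feet i) → Vertex n feet

data Edge (n : ℕ) (feet : Fin (suc n) → ℕ) : Set where
  cycE  : Fin (suc n) → Edge n feet
  footE : (i : Fin (suc n)) → Fin (feet i) → Edge n feet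

ends : {n : ℕ} {feet : Fin (suc n) → ℕ} → Edge n feet → Vertex n feet × Vertex n feet
ends (cycE i)    = cv i , cv (next i)
ends (footE i j) = cv i , foot i j

Joins : {n : ℕ} {feet : Fin (suc n) → ℕ} → Edge n feet → Vertex n feet → Vertex n feet → Set
Joins e x y = (ends e ≡ (x , y)) ⊎ (ends e ≡ (y , x))

-- An edge-coloring with k colors (not necessarily proper).
Coloring : (k n : ℕ) (feet : Fin (suc n) → ℕ) → Set
Coloring k n feet = Edge n feet → Fin k

data PCWalkFrom {k n : ℕ} {feet : Fin (suc n) → ℕ} (c : Coloring k n feet)
       : Vertex n feet → Edge n feet → Vertex n feet → Set where
  single : ∀ {x e y} → Joins e x y → PCWalkFrom c x e y
  step   : ∀ {x e z e' y} → Joins e x z → c e ≢ c e' → PCWalkFrom c z e' y → PCWalkFrom c x e y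

PCWalk : {k n : ℕ} {feet : Fin (suc n) → ℕ} (c : Coloring k n feet) → Vertex n feet → Vertex n feet → Set
PCWalk c x y = (x ≡ y) ⊎ (Σ _ λ e → PCWalkFrom c x e y)

GoodColoring : {k n : ℕ} {feet : Fin (suc n) → ℕ} → Coloring k n feet → Set
GoodColoring {n = n} {feet} c = (x y : Vertex n feet) → PCWalk c x y

HasGoodColoring : (k n : ℕ) (feet : Fin (suc n) → ℕ) → Set
HasGoodColoring k n feet = Σ (Coloring k n feet) GoodColoring

pW≡ : (n : ℕ) (feet : Fin (suc n) → ℕ) (p : ℕ) → Set
pW≡ n feet p = HasGoodColoring p n feet × ((k : ℕ) → HasGoodColoring k n feet → p ≤ k)

module Submission where

-- A properly coloured walk leaving a cycle vertex along a cycle edge cannot turn back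
-- (that repeats a colour) and a foot is a dead end, so it runs on in one direction and
-- stops at the first vertex whose two cycle edges share a colour.  An odd cycle with two
-- colours has such a monochromatic vertex p, which therefore blocks walks from both sides.
-- This leaves at most one foot at each neighbour of p; a foot at any farther vertex x
-- would need the colour of both cycle edges at x, making x a second monochromatic vertex,
-- and two of those cut the cycle apart.  Conversely, colouring the cycle alternately from
-- p = next u, so that p is the only monochromatic vertex, and the feet of p with the other
-- colour gives a good 2-colouring; a single colour fails as soon as there is a foot.

open import Defs
open import Data.Empty using (⊥; ⊥-elim)
open import Data.Fin using (Fin; toℕ; fromℕ<) renaming (zero to fzero; suc to fsuc)
open import Data.Fin.Properties using (toℕ-injective; toℕ-fromℕ<; toℕ<n; ¬Fin0; ¬∀⟶∃¬)
  renaming (_≟_ to _≟ᶠ_)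
open import Data.Nat using (ℕ; zero; suc; _+_; _*_; _∸_; _≤_; _<_; z≤n; s≤s; z<s; s<s; _%_; NonZero; _<?_)
open import Data.Nat.DivMod using (m<n⇒m%n≡m; m%n<n; %-distribˡ-+; m%n%n≡m%n; [m+n]%n≡m%n; m≤n⇒[n∸m]%m≡n%m)
open import Data.Nat.GeneralisedArithmetic using (fold; fold-+)
open import Data.Nat.Properties
open import Data.Product using (∃-syntax; _×_; _,_; proj₁; proj₂)
open import Data.Sum using (inj₁; inj₂)
open import Function.Base using (_∘_)
open import Function.Bundles using (_⇔_; mk⇔)
open import Relation.Binary.Definitions using (tri<; tri≈; tri>)
open import Relation.Binary.PropositionalEquality
open import Relation.Nullary using (¬_; yes; no; ¬?)
open import Relation.Nullary.Decidable using (decidable-stable)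

module _ {A : Set} (f : A → A) where

  fold-commute : ∀ x k → fold (f x) f k ≡ f (fold x f k)
  fold-commute x zero    = refl
  fold-commute x (suc k) = cong f (fold-commute x k)

  fold-∸ : ∀ x {a b} → a ≤ b → fold x f b ≡ fold (fold x f a) f (b ∸ a)
  fold-∸ x {a} {b} a≤b = trans (cong (fold x f) (sym (m∸n+n≡m a≤b))) (fold-+ x f (b ∸ a))

fold-inverse : ∀ {A : Set} {f g : A → A} → (∀ x → f (g x) ≡ x) → ∀ k x → fold (fold x g k) f k ≡ x
fold-inverse         fg zero    x = refl
fold-inverse {f = f} {g} fg (suc k) x = begin
  f (fold (g y) f k)  ≡⟨ fold-commute f (g y) k ⟨
  fold (f (g y)) f k  ≡⟨ cong (λ z → fold z f k) (fg y) ⟩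
  fold y f k          ≡⟨ fold-inverse fg k x ⟩
  x                   ∎
  where
  open ≡-Reasoning
  y = fold x g k

module _ {A : Set} {f : A → A} {N : ℕ} (aperiodic : ∀ d x → 0 < d → d < N → fold x f d ≢ x) where

  fold-distinct : ∀ x {a b} → a < b → b ∸ a < N → fold x f a ≢ fold x f b
  fold-distinct x {a} {b} a<b b∸a<N eq =
    aperiodic (b ∸ a) (fold x f a) (m<n⇒0<n∸m a<b) b∸a<N (sym (trans eq (fold-∸ f x (<⇒≤ a<b))))

  fold-injective : ∀ x {a b} → a < N → b < N → fold x f a ≡ fold x f b → a ≡ b
  fold-injective x {a} {b} a<N b<N eq with <-cmp a b
  ... | tri< a<b _ _ = ⊥-elim (fold-distinct x a<b (≤-<-trans (m∸n≤m b a) b<N) eq)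
  ... | tri≈ _ a≡b _ = a≡b
  ... | tri> _ _ b<a = ⊥-elim (fold-distinct x b<a (≤-<-trans (m∸n≤m a b) a<N) (sym eq))

[m+n%o]%o≡[m+n]%o : ∀ m n o .{{_ : NonZero o}} → (m + n % o) % o ≡ (m + n) % o
[m+n%o]%o≡[m+n]%o m n o = begin
  (m + n % o) % o          ≡⟨ %-distribˡ-+ m (n % o) o ⟩
  (m % o + n % o % o) % o  ≡⟨ cong (λ z → (m % o + z) % o) (m%n%n≡m%n n o) ⟩
  (m % o + n % o) % o      ≡⟨ %-distribˡ-+ m n o ⟨
  (m + n) % o              ∎
  where open ≡-Reasoning

[m+d]%n≢m : ∀ {m d n} .{{_ : NonZero n}} → m < n → 0 < d → d < n → (m + d) % n ≢ m
[m+d]%n≢m {m} {d} {n} m<n 0<d d<n eq with m + d <? n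
... | yes m+d<n = <-irrefl (sym (trans (sym (m<n⇒m%n≡m m+d<n)) eq)) (m<m+n m 0<d)
... | no m+d≮n = <-irrefl (+-cancelˡ-≡ m d n m+d≡m+n) d<n
  where
  open ≡-Reasoning
  n≤m+d = ≮⇒≥ m+d≮n
  m+d∸n≡m : m + d ∸ n ≡ m
  m+d∸n≡m = begin
    m + d ∸ n        ≡⟨ m<n⇒m%n≡m (m<n+o⇒m∸n<o (m + d) n (+-mono-< m<n d<n)) ⟨
    (m + d ∸ n) % n  ≡⟨ m≤n⇒[n∸m]%m≡n%m n≤m+d ⟩
    (m + d) % n      ≡⟨ eq ⟩
    m                ∎
  m+d≡m+n : m + d ≡ m + n
  m+d≡m+n = begin
    m + d          ≡⟨ m∸n+n≡m n≤m+d ⟨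
    m + d ∸ n + n  ≡⟨ cong (_+ n) m+d∸n≡m ⟩
    m + n          ∎

module _ {n : ℕ} where

  toℕ-fold-next : ∀ k (x : Fin (suc n)) → toℕ (fold x next k) ≡ (toℕ x + k) % suc n
  toℕ-fold-next zero x = begin
    toℕ x                ≡⟨ m<n⇒m%n≡m (toℕ<n x) ⟨
    toℕ x % suc n        ≡⟨ cong (_% suc n) (+-identityʳ (toℕ x)) ⟨
    (toℕ x + 0) % suc n  ∎
    where open ≡-Reasoning
  toℕ-fold-next (suc k) x = begin
    toℕ (next (fold x next k))           ≡⟨ toℕ-fromℕ< _ ⟩
    suc (toℕ (fold x next k)) % suc n    ≡⟨ cong (λ z → suc z % suc n) (toℕ-fold-next k x) ⟩
    (1 + (toℕ x + k) % suc n) % suc n    ≡⟨ [m+n%o]%o≡[m+n]%o 1 (toℕ x + k) (suc n) ⟩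
    suc (toℕ x + k) % suc n              ≡⟨ cong (_% suc n) (+-suc (toℕ x) k) ⟨
    (toℕ x + suc k) % suc n              ∎
    where open ≡-Reasoning

  fold-next-period : ∀ (x : Fin (suc n)) → fold x next (suc n) ≡ x
  fold-next-period x = toℕ-injective (begin
    toℕ (fold x next (suc n))  ≡⟨ toℕ-fold-next (suc n) x ⟩
    (toℕ x + suc n) % suc n    ≡⟨ [m+n]%n≡m%n (toℕ x) (suc n) ⟩
    toℕ x % suc n              ≡⟨ m<n⇒m%n≡m (toℕ<n x) ⟩
    toℕ x                      ∎)
    where open ≡-Reasoning

  fold-next-aperiodic : ∀ d (x : Fin (suc n)) → 0 < d → d < suc n → fold x next d ≢ x
  fold-next-aperiodic d x 0<d d<N eq =
    [m+d]%n≢m (toℕ<n x) 0<d d<N (trans (sym (toℕ-fold-next d x)) (cong toℕ eq))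

  fold-next-reaches : ∀ (p x : Fin (suc n)) → ∃[ s ] (s < suc n × fold p next s ≡ x)
  fold-next-reaches p x = s , m%n<n (N ∸ toℕ p + toℕ x) N , toℕ-injective (begin
    toℕ (fold p next s)                   ≡⟨ toℕ-fold-next s p ⟩
    (toℕ p + s) % N                       ≡⟨ [m+n%o]%o≡[m+n]%o (toℕ p) _ N ⟩
    (toℕ p + (N ∸ toℕ p + toℕ x)) % N     ≡⟨ cong (_% N) (+-assoc (toℕ p) _ _) ⟨
    (toℕ p + (N ∸ toℕ p) + toℕ x) % N     ≡⟨ cong (λ z → (z + toℕ x) % N) (m+[n∸m]≡n (<⇒≤ (toℕ<n p))) ⟩
    (N + toℕ x) % N                       ≡⟨ cong (_% N) (+-comm N (toℕ x)) ⟩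
    (toℕ x + N) % N                       ≡⟨ [m+n]%n≡m%n (toℕ x) N ⟩
    toℕ x % N                             ≡⟨ m<n⇒m%n≡m (toℕ<n x) ⟩
    toℕ x                                 ∎)
    where
    open ≡-Reasoning
    N = suc n
    s = (N ∸ toℕ p + toℕ x) % N

  prev : Fin (suc n) → Fin (suc n)
  prev x = fold x next n

  next-prev : ∀ x → next (prev x) ≡ x
  next-prev = fold-next-period

  prev-next : ∀ x → prev (next x) ≡ x
  prev-next x = trans (fold-commute next x n) (fold-next-period x)

module _ {n : ℕ} {feet : Fin (suc n) → ℕ} where

  cv-injective : ∀ {x y : Fin (suc n)} → cv {feet = feet} x ≡ cv y → x ≡ y
  cv-injective refl = refl

  Joins-sym : ∀ {e} {x y : Vertex n feet} → Joins e x y → Joins e y x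
  Joins-sym (inj₁ p) = inj₂ p
  Joins-sym (inj₂ p) = inj₁ p

  Joins-deterministic : ∀ {e} {x y y′ : Vertex n feet} → Joins e x y → Joins e x y′ → y ≡ y′
  Joins-deterministic (inj₁ p) (inj₁ q) = cong proj₂ (trans (sym p) q)
  Joins-deterministic (inj₁ p) (inj₂ q) = trans (cong proj₂ (trans (sym p) q)) (cong proj₁ (trans (sym p) q))
  Joins-deterministic (inj₂ p) (inj₁ q) = trans (cong proj₁ (trans (sym p) q)) (cong proj₂ (trans (sym p) q))
  Joins-deterministic (inj₂ p) (inj₂ q) = cong proj₁ (trans (sym p) q)

  Joins-foot : ∀ {e x j} {y : Vertex n feet} → Joins e (foot x j) y → e ≡ footE x j × y ≡ cv x
  Joins-foot {cycE _}    (inj₁ ())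
  Joins-foot {cycE _}    (inj₂ ())
  Joins-foot {footE _ _} (inj₁ ())
  Joins-foot {footE _ _} (inj₂ refl) = refl , refl

  data Attached (x : Fin (suc n)) : Vertex n feet → Set where
    self    : Attached x (cv x)
    pendant : (j : Fin (feet x)) → Attached x (foot x j)

  Attached-cv : ∀ {x y} → Attached x (cv y) → x ≡ y
  Attached-cv self = refl

  Attached-foot : ∀ {x y j} → Attached x (foot y j) → x ≡ y
  Attached-foot (pendant _) = refl

module _ {k n : ℕ} {feet : Fin (suc n) → ℕ} (c : Coloring k n feet) where

  data PCWalkFromTo : Vertex n feet → Edge n feet → Vertex n feet → Edge n feet → Set where
    single : ∀ {x e y} → Joins e x y → PCWalkFromTo x e y e
    step   : ∀ {x e z e′ y f} → Joins e x z → c e ≢ c e′ → PCWalkFromTo z e′ y f → PCWalkFromTo x e y f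

  snoc : ∀ {x e z f g y} → PCWalkFromTo x e z f → Joins g z y → c f ≢ c g → PCWalkFromTo x e y g
  snoc (single h)    h′ ne′ = step h ne′ (single h′)
  snoc (step h ne w) h′ ne′ = step h ne (snoc w h′ ne′)

  reverseWalk : ∀ {x e y f} → PCWalkFromTo x e y f → PCWalkFromTo y f x e
  reverseWalk (single h)    = single (Joins-sym h)
  reverseWalk (step h ne w) = snoc (reverseWalk w) (Joins-sym h) (ne ∘ sym)

  forgetLast : ∀ {x e y f} → PCWalkFromTo x e y f → PCWalkFrom c x e y
  forgetLast (single h)    = single h
  forgetLast (step h ne w) = step h ne (forgetLast w)

  recordLast : ∀ {x e y} → PCWalkFrom c x e y → ∃[ f ] PCWalkFromTo x e y f
  recordLast (single h)    = _ , single h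
  recordLast (step h ne w) = let (f , w′) = recordLast w in f , step h ne w′

  toPCWalk : ∀ {x e y f} → PCWalkFromTo x e y f → PCWalk c x y
  toPCWalk w = inj₂ (_ , forgetLast w)

  PCWalk-sym : ∀ {x y} → PCWalk c x y → PCWalk c y x
  PCWalk-sym (inj₁ eq)      = inj₁ (sym eq)
  PCWalk-sym (inj₂ (_ , w)) = toPCWalk (reverseWalk (proj₂ (recordLast w)))

  walkHead : ∀ {x e y} → PCWalkFrom c x e y → ∃[ z ] Joins e x z
  walkHead (single h)   = _ , h
  walkHead (step h _ _) = _ , h

  stuckInFoot : ∀ {x j y} → PCWalkFrom c (cv x) (footE x j) y → y ≡ foot x j
  stuckInFoot (single (inj₁ refl)) = refl
  stuckInFoot (single (inj₂ ()))
  stuckInFoot (step (inj₂ ()) _ _)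
  stuckInFoot (step (inj₁ refl) ne w) = ⊥-elim (ne (cong c (sym (proj₁ (Joins-foot (proj₂ (walkHead w)))))))

  -- `root` carries an equation instead of the index cv x, so that it can still be matched
  -- when the target is a compound vertex such as cv (ahead (ahead p)).
  data FromFoot (x : Fin (suc n)) (j : Fin (feet x)) : Vertex n feet → Set where
    stay   : FromFoot x j (foot x j)
    root   : ∀ {x′} → x ≡ x′ → FromFoot x j (cv x′)
    onward : ∀ {e y} → c (footE x j) ≢ c e → PCWalkFrom c (cv x) e y → FromFoot x j y

  fromFoot : ∀ {x j y} → PCWalk c (foot x j) y → FromFoot x j y
  fromFoot (inj₁ refl) = stay
  fromFoot (inj₂ (_ , single h)) with Joins-foot h
  ... | refl , refl = root refl
  fromFoot (inj₂ (_ , step h ne w)) with Joins-foot h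
  ... | refl , refl = onward ne w

-- Orientations of the cycle

module _ {n : ℕ} {feet : Fin (suc n) → ℕ} where

  data Incidence (ahead behind : Fin (suc n) → Fin (suc n)) (edgeAhead : Fin (suc n) → Edge n feet)
                 (z : Fin (suc n)) : Edge n feet → Vertex n feet → Set where
    viaAhead  : Incidence ahead behind edgeAhead z (edgeAhead z) (cv (ahead z))
    viaBehind : Incidence ahead behind edgeAhead z (edgeAhead (behind z)) (cv (behind z))
    viaFoot   : (j : Fin (feet z)) → Incidence ahead behind edgeAhead z (footE z j) (foot z j)

  next-incidence : ∀ {z e y} → Joins e (cv z) y → Incidence next prev cycE z e y
  next-incidence {e = cycE i}    (inj₁ refl) = viaAhead
  next-incidence {e = cycE i}    (inj₂ refl) =
    subst (λ x → Incidence next prev cycE (next i) (cycE x) (cv x)) (prev-next i) viaBehind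
  next-incidence {e = footE i j} (inj₁ refl) = viaFoot j
  next-incidence {e = footE i j} (inj₂ ())

-- A direction of travel around the cycle: each argument about walks running one way is
-- made once and applied to both `forward` and `backward`.
record Orientation {n : ℕ} (feet : Fin (suc n) → ℕ) : Set where
  field
    ahead behind    : Fin (suc n) → Fin (suc n)
    edgeAhead       : Fin (suc n) → Edge n feet
    ahead-behind    : ∀ x → ahead (behind x) ≡ x
    behind-ahead    : ∀ x → behind (ahead x) ≡ x
    edgeAhead-joins : ∀ x → Joins (edgeAhead x) (cv x) (cv (ahead x))
    incidence       : ∀ {z e y} → Joins e (cv z) y → Incidence ahead behind edgeAhead z e y
    ahead-period    : ∀ x → fold x ahead (suc n) ≡ x
    ahead-aperiodic : ∀ d x → 0 < d → d < suc n → fold x ahead d ≢ x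
    ahead-reaches   : ∀ p x → ∃[ s ] (s < suc n × fold p ahead s ≡ x)

forward : ∀ {n} {feet : Fin (suc n) → ℕ} → Orientation feet
forward = record
  { ahead           = next
  ; behind          = prev
  ; edgeAhead       = cycE
  ; ahead-behind    = next-prev
  ; behind-ahead    = prev-next
  ; edgeAhead-joins = λ _ → inj₁ refl
  ; incidence       = next-incidence
  ; ahead-period    = fold-next-period
  ; ahead-aperiodic = fold-next-aperiodic
  ; ahead-reaches   = fold-next-reaches
  }

opposite : ∀ {n} {feet : Fin (suc n) → ℕ} → Orientation feet → Orientation feet
opposite {n} {feet} D = record
  { ahead           = behind
  ; behind          = ahead
  ; edgeAhead       = edgeAhead ∘ behind
  ; ahead-behind    = behind-ahead
  ; behind-ahead    = ahead-behind
  ; edgeAhead-joins = λ x → Joins-sym (subst (Joins (edgeAhead (behind x)) (cv (behind x)) ∘ cv)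
                                             (ahead-behind x) (edgeAhead-joins (behind x)))
  ; incidence       = opposite-incidence ∘ incidence
  ; ahead-period    = λ x → trans (sym (ahead-period _)) (fold-inverse {f = ahead} {behind} ahead-behind (suc n) x)
  ; ahead-aperiodic = λ d x 0<d d<N eq →
      ahead-aperiodic d x 0<d d<N (trans (cong (λ y → fold y ahead d) (sym eq)) (fold-inverse {f = ahead} {behind} ahead-behind d x))
  ; ahead-reaches   = λ p x → let (s , s<N , e) = ahead-reaches x p in
      s , s<N , trans (cong (λ y → fold y behind s) (sym e)) (fold-inverse {f = behind} {ahead} behind-ahead s x)
  }
  where
  open Orientation D
  opposite-incidence : ∀ {z e y} → Incidence ahead behind edgeAhead z e y →
                       Incidence behind ahead (edgeAhead ∘ behind) z e y
  opposite-incidence {z} viaAhead =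
    subst (λ x → Incidence behind ahead (edgeAhead ∘ behind) z (edgeAhead x) (cv (ahead z)))
          (behind-ahead z) viaBehind
  opposite-incidence viaBehind   = viaAhead
  opposite-incidence (viaFoot j) = viaFoot j

backward : ∀ {n} {feet : Fin (suc n) → ℕ} → Orientation feet
backward = opposite forward

module Runs {k n : ℕ} {feet : Fin (suc n) → ℕ} (c : Coloring k n feet) (D : Orientation feet) where
  open Orientation D

  ahead^ : ℕ → Fin (suc n) → Fin (suc n)
  ahead^ s b = fold b ahead s

  Monochromatic : Fin (suc n) → Set
  Monochromatic q = c (edgeAhead (behind q)) ≡ c (edgeAhead q)

  data Departure (z : Fin (suc n)) : Edge n feet → Vertex n feet → Set where
    goAhead  : ∀ {y} → Departure z (edgeAhead z) y
    goBehind : ∀ {y} → Departure z (edgeAhead (behind z)) y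
    goFoot   : (j : Fin (feet z)) → Departure z (footE z j) (foot z j)

  departure : ∀ {z e y} → PCWalkFrom c (cv z) e y → Departure z e y
  departure w with walkHead c w
  ... | _ , h with incidence h
  ...   | viaAhead  = goAhead
  ...   | viaBehind = goBehind
  ...   | viaFoot j with stuckInFoot c w
  ...     | refl = goFoot j

  runsAhead : ∀ b m → Monochromatic (ahead^ m b) → ∀ t → t < m → ∀ {y} →
              PCWalkFrom c (cv (ahead^ t b)) (edgeAhead (ahead^ t b)) y →
              ∃[ s ] (t < s × s ≤ m × Attached (ahead^ s b) y)
  runsAhead b m mono t t<m (single h) with Joins-deterministic h (edgeAhead-joins (ahead^ t b))
  ... | refl = suc t , ≤-refl , t<m , self
  runsAhead b m mono t t<m (step h ne w) with Joins-deterministic h (edgeAhead-joins (ahead^ t b))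
  ... | refl with departure w
  ...   | goFoot j = suc t , ≤-refl , t<m , pendant j
  ...   | goBehind = ⊥-elim (ne (cong (c ∘ edgeAhead) (sym (behind-ahead (ahead^ t b)))))
  ...   | goAhead with m≤n⇒m<n∨m≡n t<m
  ...     | inj₂ refl = ⊥-elim (ne (trans (cong (c ∘ edgeAhead) (sym (behind-ahead (ahead^ t b)))) mono))
  ...     | inj₁ t+1<m =
    let (s , t+1<s , s≤m , a) = runsAhead b m mono (suc t) t+1<m w in s , <-trans (n<1+n t) t+1<s , s≤m , a

module _ {k n : ℕ} {feet : Fin (suc n) → ℕ} (c : Coloring k n feet) (D : Orientation feet) where
  open Orientation D
  open Runs c D using (Monochromatic)
  private module Opp = Runs c (opposite D)

  Monochromatic⇒opposite : ∀ {q} → Monochromatic q → Opp.Monochromatic q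
  Monochromatic⇒opposite {q} mono = trans (cong (c ∘ edgeAhead) (behind-ahead q)) (sym mono)

  opposite⇒Monochromatic : ∀ {q} → Opp.Monochromatic q → Monochromatic q
  opposite⇒Monochromatic {q} mono = trans (sym mono) (cong (c ∘ edgeAhead) (behind-ahead q))

-- Good colourings with two colours

≢∧≢⇒≡ : {a b d : Fin 2} → a ≢ b → d ≢ b → a ≡ d
≢∧≢⇒≡ {fzero}      {fzero}      {_}          a≢b _   = ⊥-elim (a≢b refl)
≢∧≢⇒≡ {fsuc fzero} {fsuc fzero} {_}          a≢b _   = ⊥-elim (a≢b refl)
≢∧≢⇒≡ {_}          {fzero}      {fzero}      _   d≢b = ⊥-elim (d≢b refl)
≢∧≢⇒≡ {_}          {fsuc fzero} {fsuc fzero} _   d≢b = ⊥-elim (d≢b refl)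
≢∧≢⇒≡ {fzero}      {fsuc fzero} {fzero}      _   _   = refl
≢∧≢⇒≡ {fsuc fzero} {fzero}      {fsuc fzero} _   _   = refl

Fin-unique⇒≤1 : ∀ {k} → ((i j : Fin k) → i ≡ j) → k ≤ 1
Fin-unique⇒≤1 {zero}        _      = z≤n
Fin-unique⇒≤1 {suc zero}    _      = s≤s z≤n
Fin-unique⇒≤1 {suc (suc k)} unique with unique fzero (fsuc fzero)
... | ()

≤1⇒Fin-unique : ∀ {k} → k ≤ 1 → (i j : Fin k) → i ≡ j
≤1⇒Fin-unique (s≤s z≤n) fzero fzero = refl

¬Fin⇒≡0 : ∀ {k} → ¬ Fin k → k ≡ 0
¬Fin⇒≡0 {zero}  _    = refl
¬Fin⇒≡0 {suc k} ¬fin = ⊥-elim (¬fin fzero)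

module TwoColouring {n : ℕ} {feet : Fin (suc n) → ℕ} (c : Coloring 2 n feet) (good : GoodColoring c)
                    (2≤n : 2 ≤ n) (D : Orientation feet) where
  open Orientation D
  open Runs c D
  private module Opp = Runs c (opposite D)

  1<N : 1 < suc n
  1<N = s≤s (≤-trans (s≤s z≤n) 2≤n)

  ahead^-distinct : ∀ b {a s} → a < s → s ∸ a < suc n → ahead^ a b ≢ ahead^ s b
  ahead^-distinct = fold-distinct ahead-aperiodic

  ahead-≢ : ∀ x → ahead x ≢ x
  ahead-≢ x = ahead-aperiodic 1 x (s≤s z≤n) 1<N

  ahead²-≢ : ∀ x → ahead (ahead x) ≢ x
  ahead²-≢ x = ahead-aperiodic 2 x (s≤s z≤n) (s≤s 2≤n)

  behind-≢ : ∀ x → behind x ≢ x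
  behind-≢ x eq = ahead-≢ x (trans (cong ahead (sym eq)) (ahead-behind x))

  ahead^-n : ∀ p → ahead^ n p ≡ behind p
  ahead^-n p = trans (sym (behind-ahead (ahead^ n p))) (cong behind (ahead-period p))

  Monochromatic-period : ∀ {p} → Monochromatic p → Monochromatic (ahead^ (suc n) p)
  Monochromatic-period {p} = subst Monochromatic (sym (ahead-period p))

  stopsBehind : ∀ {p y} → Monochromatic p → PCWalkFrom c (cv (ahead p)) (edgeAhead (behind (ahead p))) y →
                Attached p y
  stopsBehind {p} {y} mono w
    with Opp.runsAhead (ahead p) 1 (subst Opp.Monochromatic (sym (behind-ahead p)) (Monochromatic⇒opposite c D mono))
                       0 (s≤s z≤n) w
  ... | suc zero    , _ , _       , a = subst (λ x → Attached x y) (behind-ahead p) a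
  ... | suc (suc _) , _ , s≤s () , _

  far-position : ∀ {p x} → x ≢ p → x ≢ ahead p → x ≢ behind p → ∃[ k ] (2 ≤ k × k < n × ahead^ k p ≡ x)
  far-position {p} {x} x≢p x≢p⁺ x≢p⁻ with ahead-reaches p x
  ... | zero          , _   , e = ⊥-elim (x≢p (sym e))
  ... | suc zero      , _   , e = ⊥-elim (x≢p⁺ (sym e))
  ... | suc (suc k) , k<N , e = suc (suc k) , s≤s (s≤s z≤n) , ≤∧≢⇒< (≤-pred k<N) k≢n , e
    where
    k≢n : suc (suc k) ≢ n
    k≢n eq = x≢p⁻ (trans (sym e) (trans (cong (λ i → ahead^ i p) eq) (ahead^-n p)))

  feet-ahead-distinctColours : ∀ {p} → Monochromatic p → ∀ {j j′} → j ≢ j′ →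
                               c (footE (ahead p) j) ≢ c (footE (ahead p) j′)
  feet-ahead-distinctColours {p} mono {j} {j′} j≢j′ same
    with fromFoot c (good (foot (ahead p) j) (foot (ahead p) j′))
  ... | stay = j≢j′ refl
  ... | onward ne w with departure w
  ...   | goFoot _ = ne same
  ...   | goBehind = ahead-≢ p (sym (Attached-foot (stopsBehind mono w)))
  ...   | goAhead with runsAhead p (suc n) (Monochromatic-period mono) 1 1<N w
  ...     | s , 1<s , s≤N , a =
    ahead^-distinct p 1<s (≤-<-trans (∸-mono s≤N (≤-refl {1})) (n<1+n n)) (sym (Attached-foot a))

  footColour≢aheadColour : ∀ {p} → Monochromatic p → ∀ j → c (footE (ahead p) j) ≢ c (edgeAhead (ahead p))
  footColour≢aheadColour {p} mono j same with fromFoot c (good (foot (ahead p) j) (cv (ahead (ahead p))))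
  ... | root eq = ahead-≢ (ahead p) (sym eq)
  ... | onward ne w with departure w
  ...   | goAhead  = ne same
  ...   | goBehind = ahead²-≢ p (sym (Attached-cv (stopsBehind mono w)))

  feet-ahead-≤1 : ∀ {p} → Monochromatic p → feet (ahead p) ≤ 1
  feet-ahead-≤1 mono = Fin-unique⇒≤1 λ j j′ → decidable-stable (j ≟ᶠ j′) λ j≢j′ →
    feet-ahead-distinctColours mono j≢j′
      (≢∧≢⇒≡ (footColour≢aheadColour mono j) (footColour≢aheadColour mono j′))

  Monochromatic-isolated : ∀ {p x} → Monochromatic p → x ≢ p → x ≢ ahead p → x ≢ behind p → ¬ Monochromatic x
  Monochromatic-isolated {p} mono x≢p x≢p⁺ x≢p⁻ mono′ with far-position x≢p x≢p⁺ x≢p⁻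
  ... | k , 2≤k , k<n , refl with good (cv (ahead p)) (cv (behind p))
  ...   | inj₁ eq = ahead²-≢ p (trans (cong ahead (cv-injective eq)) (ahead-behind p))
  ...   | inj₂ (_ , w) with departure w
  ...     | goBehind = behind-≢ p (sym (Attached-cv (stopsBehind mono w)))
  ...     | goAhead with runsAhead p k mono′ 1 2≤k w
  ...       | s , _ , s≤k , a = ahead^-distinct p (≤-<-trans s≤k k<n) (≤-<-trans (m∸n≤m n s) (n<1+n n))
                                   (trans (Attached-cv a) (sym (ahead^-n p)))

  private
    far-foot-against-ahead : ∀ {p} k → Monochromatic p → 1 ≤ k → suc k < n →
                             ¬ Monochromatic (ahead^ (suc k) p) → ∀ j →
                             c (footE (ahead^ (suc k) p) j) ≢ c (edgeAhead (ahead^ (suc k) p)) → ⊥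
    far-foot-against-ahead {p} k mono 1≤k k+1<n ¬mono j differ
      with fromFoot c (good (foot (ahead^ (suc k) p) j) (cv (behind (ahead^ (suc k) p))))
    ... | root eq = behind-≢ _ (sym eq)
    ... | onward ne w with departure w
    ...   | goBehind = ne (≢∧≢⇒≡ differ ¬mono)
    ...   | goAhead with runsAhead p (suc n) (Monochromatic-period mono) (suc k) (<-trans k+1<n (n<1+n n)) w
    ...     | s , k+1<s , s≤N , a = ahead^-distinct p (<-trans (n<1+n k) k+1<s)
                                      (≤-<-trans (∸-mono s≤N 1≤k) (n<1+n n))
                                      (sym (trans (Attached-cv a) (behind-ahead (ahead^ k p))))

  far-foot-colour : ∀ {p x} → Monochromatic p → x ≢ p → x ≢ ahead p → x ≢ behind p → ¬ Monochromatic x →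
                    ∀ j → c (footE x j) ≡ c (edgeAhead x)
  far-foot-colour mono x≢p x≢p⁺ x≢p⁻ ¬mono j with far-position x≢p x≢p⁺ x≢p⁻
  ... | suc k , s≤s 1≤k , k+1<n , refl =
    decidable-stable (_ ≟ᶠ _) (far-foot-against-ahead k mono 1≤k k+1<n ¬mono j)

FeetOnTriple : ∀ {n} (feet : Fin (suc n) → ℕ) → Fin (suc n) → Set
FeetOnTriple {n} feet u = feet u ≤ 1 × feet (next (next u)) ≤ 1 ×
  ((x : Fin (suc n)) → x ≢ u → x ≢ next u → x ≢ next (next u) → feet x ≡ 0)

module _ {n : ℕ} {feet : Fin (suc n) → ℕ} (c : Coloring 2 n feet) (good : GoodColoring c) (2≤n : 2 ≤ n) where
  private
    module F = TwoColouring c good 2≤n forward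
    module B = TwoColouring c good 2≤n backward

  far-footless : ∀ {p x} → Runs.Monochromatic c forward p → x ≢ p → x ≢ next p → x ≢ prev p → feet x ≡ 0
  far-footless {p} {x} mono x≢p x≢p⁺ x≢p⁻ with c (cycE (prev x)) ≟ᶠ c (cycE x)
  ... | yes mono′ = ⊥-elim (F.Monochromatic-isolated mono x≢p x≢p⁺ x≢p⁻ mono′)
  ... | no ¬mono  = ¬Fin⇒≡0 λ j → ¬mono (trans
      (sym (B.far-foot-colour (Monochromatic⇒opposite c forward mono) x≢p x≢p⁻ x≢p⁺
                              (¬mono ∘ opposite⇒Monochromatic c forward) j))
      (F.far-foot-colour mono x≢p x≢p⁺ x≢p⁻ ¬mono j))

  Monochromatic⇒FeetOnTriple : ∀ {p} → Runs.Monochromatic c forward p → FeetOnTriple feet (prev p)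
  Monochromatic⇒FeetOnTriple {p} mono =
    B.feet-ahead-≤1 (Monochromatic⇒opposite c forward mono) ,
    subst (λ v → feet (next v) ≤ 1) (sym (next-prev p)) (F.feet-ahead-≤1 mono) ,
    λ x x≢u x≢v x≢w → far-footless mono
      (λ x≡p → x≢v (trans x≡p (sym (next-prev p))))
      (λ x≡p⁺ → x≢w (trans x≡p⁺ (cong next (sym (next-prev p)))))
      x≢u

alternating-even : (col : ℕ → Fin 2) → (∀ s → col (suc s) ≢ col s) → ∀ k → col (k + k) ≡ col 0
alternating-even col alt zero    = refl
alternating-even col alt (suc k) = begin
  col (suc k + suc k)      ≡⟨ cong (col ∘ suc) (+-suc k k) ⟩
  col (suc (suc (k + k)))  ≡⟨ ≢∧≢⇒≡ (alt (suc (k + k))) (alt (k + k) ∘ sym) ⟩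
  col (k + k)              ≡⟨ alternating-even col alt k ⟩
  col 0                    ∎
  where open ≡-Reasoning

2+2*m≡[1+m]+[1+m] : ∀ m → 2 + 2 * m ≡ suc m + suc m
2+2*m≡[1+m]+[1+m] m = cong suc (trans (cong (suc ∘ (m +_)) (+-identityʳ m)) (sym (+-suc m m)))

Monochromatic-exists : ∀ {n k} {feet : Fin (suc n) → ℕ} → n ≡ k + k → (c : Coloring 2 n feet) →
                       ∃[ p ] Runs.Monochromatic c forward p
Monochromatic-exists {n} {k} n≡k+k c =
  let (p , ¬¬mono) = ¬∀⟶∃¬ (suc n) (¬_ ∘ Mono) (λ _ → ¬? (_ ≟ᶠ _)) not-all-bichromatic
  in p , decidable-stable (_ ≟ᶠ _) ¬¬mono
  where
  open ≡-Reasoning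
  Mono = Runs.Monochromatic c forward
  col : ℕ → Fin 2
  col s = c (cycE (fold fzero next s))
  not-all-bichromatic : ¬ (∀ p → ¬ Mono p)
  not-all-bichromatic bichromatic = alt (k + k) (begin
    col (suc (k + k))  ≡⟨ cong (col ∘ suc) n≡k+k ⟨
    col (suc n)        ≡⟨ cong (c ∘ cycE) (fold-next-period fzero) ⟩
    col 0              ≡⟨ alternating-even col alt k ⟨
    col (k + k)        ∎)
    where
    alt : ∀ s → col (suc s) ≢ col s
    alt s eq = bichromatic (fold fzero next (suc s)) (trans (cong (c ∘ cycE) (prev-next _)) (sym eq))

good-two-colouring⇒FeetOnTriple : ∀ m {feet : Fin (suc (2 + 2 * m)) → ℕ} (c : Coloring 2 (2 + 2 * m) feet) →
                                   GoodColoring c → ∃[ u ] FeetOnTriple feet u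
good-two-colouring⇒FeetOnTriple m c good =
  let (p , mono) = Monochromatic-exists {k = suc m} (2+2*m≡[1+m]+[1+m] m) c
  in prev p , Monochromatic⇒FeetOnTriple c good (s≤s (s≤s z≤n)) mono

-- An alternating colouring

parity : ℕ → Fin 2
parity zero          = fzero
parity (suc zero)    = fsuc fzero
parity (suc (suc t)) = parity t

parity-suc≢ : ∀ t → parity (suc t) ≢ parity t
parity-suc≢ zero          ()
parity-suc≢ (suc zero)    ()
parity-suc≢ (suc (suc t)) = parity-suc≢ t

parity-2+2* : ∀ m → parity (2 + 2 * m) ≡ fzero
parity-2+2* m = trans (cong parity (2+2*m≡[1+m]+[1+m] m)) (alternating-even parity parity-suc≢ (suc m))

parity-1+2* : ∀ m → parity (suc (2 * m)) ≡ fsuc fzero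
parity-1+2* m = ≢∧≢⇒≡ (λ eq → parity-suc≢ (suc (2 * m)) (trans (parity-2+2* m) (sym eq))) λ ()

module Construction (m : ℕ) {feet : Fin (suc (2 + 2 * m)) → ℕ} (u : Fin (suc (2 + 2 * m)))
                    (triple : FeetOnTriple feet u) where
  private
    n = 2 + 2 * m
    N = suc n

  p w : Fin N
  p = next u
  w = next p

  at : ℕ → Fin N
  at t = fold p next t

  position : Fin N → ℕ
  position x = proj₁ (fold-next-reaches p x)

  colouring : Coloring 2 n feet
  colouring (cycE x) = parity (position x)
  colouring (footE x j) with x ≟ᶠ p
  ... | yes _ = fsuc fzero
  ... | no _  = fzero

  colour-at : ∀ {t} → t < N → colouring (cycE (at t)) ≡ parity t
  colour-at {t} t<N = let (s , s<N , e) = fold-next-reaches p (at t) in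
    cong parity (fold-injective fold-next-aperiodic p s<N t<N e)

  footColourAtP : ∀ j → colouring (footE p j) ≡ fsuc fzero
  footColourAtP j with p ≟ᶠ p
  ... | yes _   = refl
  ... | no p≢p = ⊥-elim (p≢p refl)

  footColourAwayFromP : ∀ {x} j → x ≢ p → colouring (footE x j) ≡ fzero
  footColourAwayFromP {x} j x≢p with x ≟ᶠ p
  ... | yes x≡p = ⊥-elim (x≢p x≡p)
  ... | no _    = refl

  at-n : at n ≡ u
  at-n = trans (fold-commute next u n) (fold-next-period u)

  u≢p : u ≢ p
  u≢p = fold-next-aperiodic 1 u (s≤s z≤n) (s≤s (s≤s z≤n)) ∘ sym

  0≢1 : fzero {1} ≢ fsuc fzero
  0≢1 ()

  run : ∀ {t s} → t ≤ s → s < N →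
        PCWalkFromTo colouring (cv (at t)) (cycE (at t)) (cv (at (suc s))) (cycE (at s))
  run {t} {s} t≤s s<N with m≤n⇒m<n∨m≡n t≤s
  ... | inj₂ refl = single (inj₁ refl)
  run {t} {suc s} _ s+1<N | inj₁ (s≤s t≤s) = snoc colouring (run t≤s s<N) (inj₁ refl) λ eq →
    parity-suc≢ s (trans (sym (colour-at s+1<N)) (trans (sym eq) (colour-at s<N)))
    where
    s<N = <-trans (n<1+n s) s+1<N

  toFootOfP : ∀ {t} → t < N → ∀ j → PCWalkFromTo colouring (cv (at t)) (cycE (at t)) (foot p j) (footE p j)
  toFootOfP {t} t<N j = snoc colouring
    (subst (λ x → PCWalkFromTo colouring (cv (at t)) (cycE (at t)) (cv x) (cycE (at n)))
           (fold-next-period p) (run (≤-pred t<N) (n<1+n n)))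
    (inj₁ refl)
    λ eq → 0≢1 (trans (sym (trans (colour-at (n<1+n n)) (parity-2+2* m))) (trans eq (footColourAtP j)))

  toFootOfU : ∀ {t} → t < n → ∀ j → PCWalkFromTo colouring (cv (at t)) (cycE (at t)) (foot u j) (footE u j)
  toFootOfU {t} t<n j = snoc colouring
    (subst (λ x → PCWalkFromTo colouring (cv (at t)) (cycE (at t)) (cv x) (cycE (at (suc (2 * m)))))
           at-n (run (≤-pred t<n) (n≤1+n n)))
    (inj₁ refl)
    λ eq → 0≢1 (trans (sym (footColourAwayFromP j u≢p)) (trans (sym eq) (trans (colour-at (n≤1+n n)) (parity-1+2* m))))

  fromFootOfP : ∀ j {y f} → PCWalkFromTo colouring (cv p) (cycE p) y f → PCWalk colouring (foot p j) y
  fromFootOfP j walk = toPCWalk colouring (step {e = footE p j} (inj₂ refl) footOfP≢ahead walk)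
    where
    footOfP≢ahead : colouring (footE p j) ≢ colouring (cycE p)
    footOfP≢ahead eq = 0≢1 (trans (sym (colour-at (s≤s z≤n))) (trans (sym eq) (footColourAtP j)))

  fromFootOfW : ∀ j {y f} → PCWalkFromTo colouring (cv w) (cycE w) y f → PCWalk colouring (foot w j) y
  fromFootOfW j walk = toPCWalk colouring (step {e = footE w j} (inj₂ refl) footOfW≢ahead walk)
    where
    footOfW≢ahead : colouring (footE w j) ≢ colouring (cycE w)
    footOfW≢ahead eq = 0≢1 (trans (sym (footColourAwayFromP j (fold-next-aperiodic 1 p (s≤s z≤n) (s≤s (s≤s z≤n)))))
                                  (trans eq (colour-at (s≤s (s≤s z≤n)))))

  cycle-cycle : ∀ {t s} → t < N → s < N → PCWalk colouring (cv (at t)) (cv (at s))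
  cycle-cycle {t} {s} t<N s<N with <-cmp t s
  ... | tri≈ _ refl _ = inj₁ refl
  cycle-cycle {t} {suc s} t<N s<N | tri< (s≤s t≤s) _ _ =
    toPCWalk colouring (run t≤s (<-trans (n<1+n s) s<N))
  cycle-cycle {suc t} {s} t<N s<N | tri> _ _ (s≤s s≤t) =
    PCWalk-sym colouring (toPCWalk colouring (run s≤t (<-trans (n<1+n t) t<N)))

  cycle-footOfU : ∀ {t} → t < N → ∀ j → PCWalk colouring (cv (at t)) (foot u j)
  cycle-footOfU t<N j with m≤n⇒m<n∨m≡n (≤-pred t<N)
  ... | inj₁ t<n = toPCWalk colouring (toFootOfU t<n j)
  ... | inj₂ refl = inj₂ (footE u j , single (subst (λ x → Joins (footE u j) (cv x) (foot u j)) (sym at-n) (inj₁ refl)))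

  footOfW-cycle : ∀ j {s} → s < N → PCWalk colouring (foot w j) (cv (at s))
  footOfW-cycle j {zero}        _   = fromFootOfW j (subst (λ x → PCWalkFromTo colouring (cv w) (cycE w) (cv x) (cycE (at n)))
                                                           (fold-next-period p) (run (s≤s z≤n) (n<1+n n)))
  footOfW-cycle j {suc zero}    _   = inj₂ (footE w j , single (inj₂ refl))
  footOfW-cycle j {suc (suc s)} s<N = fromFootOfW j (run (s≤s z≤n) (<-trans (n<1+n _) s<N))

  data Kind : Vertex n feet → Set where
    onCycle : ∀ {t} → t < N → Kind (cv (at t))
    footOfP : ∀ j → Kind (foot p j)
    footOfU : ∀ j → Kind (foot u j)
    footOfW : ∀ j → Kind (foot w j)

  kind : ∀ x → Kind x
  kind (cv x) with fold-next-reaches p x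
  ... | _ , t<N , refl = onCycle t<N
  kind (foot x j) with x ≟ᶠ p | x ≟ᶠ u | x ≟ᶠ w
  ... | yes refl | _        | _        = footOfP j
  ... | no _     | yes refl | _        = footOfU j
  ... | no _     | no _     | yes refl = footOfW j
  ... | no x≢p   | no x≢u   | no x≢w   = ⊥-elim (¬Fin0 (subst Fin (proj₂ (proj₂ triple) x x≢u x≢p x≢w) j))

  colouring-good : GoodColoring colouring
  colouring-good x y = connect (kind x) (kind y)
    where
    connect : ∀ {x y} → Kind x → Kind y → PCWalk colouring x y
    connect (onCycle t) (onCycle s)  = cycle-cycle t s
    connect (onCycle t) (footOfP j)  = toPCWalk colouring (toFootOfP t j)
    connect (onCycle t) (footOfU j)  = cycle-footOfU t j
    connect (onCycle t) (footOfW j)  = PCWalk-sym colouring (footOfW-cycle j t)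
    connect (footOfP j) (onCycle s)  = PCWalk-sym colouring (toPCWalk colouring (toFootOfP s j))
    connect (footOfP j) (footOfP j′) = fromFootOfP j (toFootOfP z<s j′)
    connect (footOfP j) (footOfU j′) = fromFootOfP j (toFootOfU z<s j′)
    connect (footOfP j) (footOfW j′) = PCWalk-sym colouring (fromFootOfW j′ (toFootOfP (s<s z<s) j))
    connect (footOfU j) (onCycle s)  = PCWalk-sym colouring (cycle-footOfU s j)
    connect (footOfU j) (footOfP j′) = PCWalk-sym colouring (fromFootOfP j′ (toFootOfU z<s j))
    connect (footOfU j) (footOfU j′) = inj₁ (cong (foot u) (≤1⇒Fin-unique (proj₁ triple) j j′))
    connect (footOfU j) (footOfW j′) = PCWalk-sym colouring (fromFootOfW j′ (toFootOfU (s<s z<s) j))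
    connect (footOfW j) (onCycle s)  = footOfW-cycle j s
    connect (footOfW j) (footOfP j′) = fromFootOfW j (toFootOfP (s<s z<s) j′)
    connect (footOfW j) (footOfU j′) = fromFootOfW j (toFootOfU (s<s z<s) j′)
    connect (footOfW j) (footOfW j′) = inj₁ (cong (foot w) (≤1⇒Fin-unique (proj₁ (proj₂ triple)) j j′))

two-colours-necessary : ∀ {k n} {feet : Fin (suc n) → ℕ} → 2 ≤ n → (∃[ i ] 1 ≤ feet i) →
                        HasGoodColoring k n feet → 2 ≤ k
two-colours-necessary {zero}        _   _              (c , _) with c (cycE fzero)
... | ()
two-colours-necessary {suc zero}    2≤n (i , 1≤feet-i) (c , good)
  with fromFoot c (good (foot i (fromℕ< 1≤feet-i)) (cv (next (next i))))
... | root eq     = ⊥-elim (fold-next-aperiodic 2 i (s≤s z≤n) (s≤s 2≤n) (sym eq))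
... | onward ne _ = ⊥-elim (ne (≤1⇒Fin-unique ≤-refl _ _))
two-colours-necessary {suc (suc k)} _   _              _ = s≤s (s≤s z≤n)

mainTheorem8 : (m : ℕ) (feet : Fin (suc (2 + 2 * m)) → ℕ) →
    (∃[ i ] 1 ≤ feet i) →
    pW≡ (2 + 2 * m) feet 2 ⇔
      (∃[ u ] (feet u ≤ 1 × feet (next (next u)) ≤ 1 ×
        ((x : Fin (suc (2 + 2 * m))) → x ≢ u → x ≢ next u → x ≢ next (next u) → feet x ≡ 0)))
mainTheorem8 m feet hasFoot = mk⇔
  (λ ((c , good) , _) → good-two-colouring⇒FeetOnTriple m c good)
  (λ (u , triple) → let open Construction m u triple in
     (colouring , colouring-good) , λ _ → two-colours-necessary (s≤s (s≤s z≤n)) hasFoot)
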